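{- For every positive integer $a$, there exists a graph that is $2a$-connected, $2a$-edge-connected, and $2^*$-dense.
   Context: All graphs are finite and simple. For an edge $uv$ of a graph $G$, the edge multiplicity is $m_G(uv)=|N_G(u)\cap N_G(v)|$. For an integer $k\ge 2$, a graph $G$ is called $k$-dense if $G$ has no isolated vertices and every edge $uv$ of $G$ satisfies $m_G(uv)\ge k-2$. A graph is $k^*$-dense if it is $k$-dense but not $(k+1)$-dense. -}

module Defs where

open import Data.Nat using (ℕ; zero; suc; _∸_; _≤_; _<_)
open import Data.Bool using (Bool; true; false; _∧_; if_then_else_)
open import Data.Fin using (Fin)
open import Data.Fin.Subset using (Subset; _∉_; ∣_∣)
open import Data.List using (List; length; map; allFin)
open import Data.Nat.ListAction using (sum)
open import Data.List.Membership.Propositional using () renaming (_∈_ to _∈ˡ_)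
open import Data.Product using (Σ; ∃; _×_; _,_)
open import Relation.Binary.PropositionalEquality using (_≡_)
open import Relation.Nullary using (¬_)

record Graph (n : ℕ) : Set where
  field
    adj    : Fin n → Fin n → Bool
    sym    : ∀ u v → adj u v ≡ adj v u
    irrefl : ∀ v → adj v v ≡ false
open Graph public

Adj : {n : ℕ} → Graph n → Fin n → Fin n → Set
Adj G u v = adj G u v ≡ true

mult : {n : ℕ} → Graph n → Fin n → Fin n → ℕ
mult {n} G u v = sum (map (λ w → if adj G u w ∧ adj G w v then 1 else 0) (allFin n))

data Walk {n : ℕ} (E : Fin n → Fin n → Set) : Fin n → Fin n → Set where
  here : ∀ {u} → Walk E u u
  step : ∀ {u w v} → E u w → Walk E w v → Walk E u v

Dense : ℕ → {n : ℕ} → Graph n → Set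
Dense k {n} G = (∀ (v : Fin n) → ∃ λ u → Adj G v u)
              × (∀ u v → Adj G u v → k ∸ 2 ≤ mult G u v)

DenseStar : ℕ → {n : ℕ} → Graph n → Set
DenseStar k G = Dense k G × ¬ Dense (suc k) G

Connected : ℕ → {n : ℕ} → Graph n → Set
Connected k {n} G = k < n ×
  (∀ (S : Subset n) → ∣ S ∣ < k → ∀ u v → u ∉ S → v ∉ S →
     Walk (λ x y → Adj G x y × x ∉ S × y ∉ S) u v)

EdgeConnected : ℕ → {n : ℕ} → Graph n → Set
EdgeConnected k {n} G = 1 < n ×
  (∀ (F : List (Fin n × Fin n)) → length F < k → ∀ u v →
     Walk (λ x y → Adj G x y × ¬ ((x , y) ∈ˡ F) × ¬ ((y , x) ∈ˡ F)) u v)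

module Submission where

-- The witness is the complete bipartite graph K_{N,N} with N = 2a.
--
-- Every graph without isolated vertices is 2-dense (the bound
--   k ∸ 2 is 0), and a graph with an edge of multiplicity 0 is not 3-dense.
--   Bipartite graphs are triangle-free, so every edge has multiplicity 0.
-- * Connectivity.  Both connectivity claims rest on one counting fact: a list
--   of fewer than N elements of Fin N misses some element (pigeonhole).
--   In K_{N,N} two vertices on opposite sides are adjacent, and two vertices
--   on the same side have N common neighbours, one for each index of the
--   other side.  Deleting fewer than N vertices, or fewer than N edges, can
--   spoil at most as many of these N two-step routes as there are deleted
--   objects, since each deleted object determines one index of the other
--   side; hence some route survives.

open import Defs
open import Data.Nat using (ℕ; _*_; _≤_)
open import Data.Product using (Σ; ∃; _×_)

open import Data.Nat using (suc; _+_; _<_; z≤n; s≤s)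
open import Data.Nat.Properties using (<⇒≱; m<m+n; ≤-trans)
open import Data.Nat.ListAction using (sum)
open import Data.Bool as Bool using (Bool; true; false; not; _xor_; _∧_; if_then_else_)
open import Data.Bool.Properties using (xor-comm; xor-same; ¬-not; not-¬)
open import Data.Fin as Fin using (Fin; splitAt; _↑ˡ_; _↑ʳ_)
open import Data.Fin.Properties using (splitAt-↑ˡ; splitAt-↑ʳ; ¬∀⟶∃¬; injective⇒≤)
open import Data.Fin.Subset as Subset using (Subset; inside; outside; ∣_∣)
open import Data.Vec using ([]; _∷_) renaming (here to hereᵛ; there to thereᵛ)
open import Data.List as List using (List; length; map; allFin; lookup)
open import Data.List.Properties using (length-map)
open import Data.List.Relation.Unary.Any using (here; there; index)
open import Data.List.Relation.Unary.Any.Properties using (lookup-index)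
open import Data.List.Membership.Propositional using (_∈_; _∉_)
open import Data.List.Membership.Propositional.Properties using (∈-map⁺)
import Data.List.Membership.DecPropositional as DecMembership
open import Data.Product using (_,_)
open import Data.Sum using (_⊎_; inj₁; inj₂; [_,_]; swap)
open import Function using (_∘_)
open import Function.Definitions using (Injective)
open import Relation.Nullary using (¬_; yes; no; contradiction)
open import Relation.Binary.PropositionalEquality
  using (_≡_; _≢_; refl; trans; cong; subst; module ≡-Reasoning)
  renaming (sym to ≡-sym)

-- Pigeonhole: a list with fewer than N entries from Fin N misses some entry.
-- If it covered Fin N, sending each w to a position holding it would be an
-- injection Fin N → Fin (length xs).
missing : ∀ {N} (xs : List (Fin N)) → length xs < N → ∃ λ w → w ∉ xs
missing {N} xs short = ¬∀⟶∃¬ N (_∈ xs) (_∈? xs) covering-impossible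
  where
    open DecMembership (Fin._≟_ {N}) using (_∈?_)

    covering-impossible : ¬ (∀ w → w ∈ xs)
    covering-impossible covers = <⇒≱ short (injective⇒≤ position-injective)
      where
        position : Fin N → Fin (length xs)
        position w = index (covers w)

        position-injective : Injective _≡_ _≡_ position
        position-injective {i} {j} same-position = begin
          i                      ≡⟨ lookup-index (covers i) ⟩
          lookup xs (position i) ≡⟨ cong (lookup xs) same-position ⟩
          lookup xs (position j) ≡⟨ ≡-sym (lookup-index (covers j)) ⟩
          j                      ∎
          where open ≡-Reasoning

avoid : ∀ {N} {A : Set} (key : A → Fin N) (xs : List A) → length xs < N →
        (Bad : Fin N → Set) → (∀ w → Bad w → w ∈ map key xs) →
        ∃ λ w → ¬ Bad w
avoid {N} key xs short Bad bad-is-key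
  with missing (map key xs) (subst (_< N) (≡-sym (length-map key xs)) short)
... | w , w∉ = w , w∉ ∘ bad-is-key w

key-∈ : ∀ {N} {A : Set} (key : A → Fin N) {xs : List A} {p : A} {w : Fin N} →
        p ∈ xs → key p ≡ w → w ∈ map key xs
key-∈ key p∈xs refl = ∈-map⁺ key p∈xs

elements : ∀ {n} → Subset n → List (Fin n)
elements []            = List.[]
elements (inside  ∷ S) = Fin.zero List.∷ map Fin.suc (elements S)
elements (outside ∷ S) = map Fin.suc (elements S)

length-elements : ∀ {n} (S : Subset n) → length (elements S) ≡ ∣ S ∣
length-elements []            = refl
length-elements (inside  ∷ S) =
  cong suc (trans (length-map Fin.suc (elements S)) (length-elements S))
length-elements (outside ∷ S) = trans (length-map Fin.suc (elements S)) (length-elements S)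

∈-elements : ∀ {n} (S : Subset n) {x} → x Subset.∈ S → x ∈ elements S
∈-elements (inside  ∷ S) hereᵛ        = here refl
∈-elements (inside  ∷ S) (thereᵛ x∈S) = there (∈-map⁺ Fin.suc (∈-elements S x∈S))
∈-elements (outside ∷ S) (thereᵛ x∈S) = ∈-map⁺ Fin.suc (∈-elements S x∈S)

2-dense : ∀ {n} (G : Graph n) → (∀ v → ∃ λ u → Adj G v u) → Dense 2 G
2-dense G no-isolated = no-isolated , λ _ _ _ → z≤n

not-3-dense : ∀ {n} (G : Graph n) {u v : Fin n} →
              Adj G u v → mult G u v ≡ 0 → ¬ Dense 3 G
not-3-dense G uv mult≡0 (_ , multiplicity-bound) =
  contradiction (subst (1 ≤_) mult≡0 (multiplicity-bound _ _ uv)) λ ()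

bipartite : ∀ {n} → (Fin n → Bool) → Graph n
bipartite side = record
  { adj    = λ u v → side u xor side v
  ; sym    = λ u v → xor-comm (side u) (side v)
  ; irrefl = λ v → xor-same (side v)
  }

crossing : ∀ {n} (side : Fin n → Bool) (u v : Fin n) →
           side u ≢ side v → Adj (bipartite side) u v
crossing side u v different with side u | side v
... | true  | false = refl
... | false | true  = refl
... | true  | true  = contradiction refl different
... | false | false = contradiction refl different

-- Two colours can't differ from a third colour and from each other at once:
-- a two-coloured graph has no triangles.
no-triangle : ∀ a b c → a xor c ≡ true → (a xor b) ∧ (b xor c) ≡ false
no-triangle false false true  _ = refl
no-triangle false true  true  _ = refl
no-triangle true  false false _ = refl
no-triangle true  true  false _ = refl

sum-map-zero : ∀ {A : Set} (f : A → ℕ) (xs : List A) → (∀ x → f x ≡ 0) → sum (map f xs) ≡ 0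
sum-map-zero f List.[]         _      = refl
sum-map-zero f (x List.∷ xs) f≡0 rewrite f≡0 x = sum-map-zero f xs f≡0

bipartite-mult : ∀ {n} (side : Fin n → Bool) {u v : Fin n} →
                 Adj (bipartite side) u v → mult (bipartite side) u v ≡ 0
bipartite-mult {n} side {u} {v} uv = sum-map-zero _ (allFin n) λ w →
  cong (λ b → if b then 1 else 0) (no-triangle (side u) (side w) (side v) uv)

-- The complete bipartite graph K_{N,N}, N = M + 1, on Fin (N + N): the first
-- N vertices form side false, the last N side true, and each side is indexed
-- by Fin N.
module CompleteBipartite (M : ℕ) where

  N : ℕ
  N = suc M

  V : Set
  V = Fin (N + N)

  side : V → Bool
  side v = [ (λ _ → false) , (λ _ → true) ] (splitAt N v)

  idx : V → Fin N
  idx v = [ (λ i → i) , (λ i → i) ] (splitAt N v)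

  opp : Bool → Fin N → V
  opp false i = N ↑ʳ i
  opp true  i = i ↑ˡ N

  side-opp : ∀ b i → side (opp b i) ≡ not b
  side-opp false i rewrite splitAt-↑ʳ N N i = refl
  side-opp true  i rewrite splitAt-↑ˡ N i N = refl

  idx-opp : ∀ b i → idx (opp b i) ≡ i
  idx-opp false i rewrite splitAt-↑ʳ N N i = refl
  idx-opp true  i rewrite splitAt-↑ˡ N i N = refl

  K : Graph (N + N)
  K = bipartite side

  to-opp : ∀ x {b} i → side x ≡ b → Adj K x (opp b i)
  to-opp x {b} i x∈b = crossing side x (opp b i) λ e → not-¬ x∈b (trans e (side-opp b i))

  from-opp : ∀ {b} i y → side y ≡ b → Adj K (opp b i) y
  from-opp {b} i y y∈b = crossing side (opp b i) y λ e → not-¬ y∈b (trans (≡-sym e) (side-opp b i))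

  other-side : ∀ u v → side u ≢ side v → side v ≡ not (side u)
  other-side u v different = ¬-not (different ∘ ≡-sym)

  2*-dense : DenseStar 2 K
  2*-dense = 2-dense K (λ v → opp (side v) (idx v) , to-opp v (idx v) refl)
           , not-3-dense K {u} {v} edge (bipartite-mult side {u} {v} edge)
    where
      u v : V
      u = opp true Fin.zero
      v = opp false Fin.zero

      edge : Adj K u v
      edge = to-opp u Fin.zero (side-opp true Fin.zero)

  N<N+N : N < N + N
  N<N+N = m<m+n N (s≤s z≤n)

  -- Vertices on different sides are adjacent; for two
  -- vertices on the same side, fewer than N deleted vertices leave some
  -- common neighbour, found by avoiding the indices of the deleted vertices.
  connected : Connected N K
  connected = N<N+N , survives
    where
      survives : ∀ (S : Subset (N + N)) → ∣ S ∣ < N → ∀ u v → u Subset.∉ S → v Subset.∉ S →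
                 Walk (λ x y → Adj K x y × x Subset.∉ S × y Subset.∉ S) u v
      survives S small u v u∉S v∉S with side u Bool.≟ side v
      ... | no different = step (crossing side u v different , u∉S , v∉S) here
      ... | yes same
          with avoid idx (elements S) (subst (_< N) (≡-sym (length-elements S)) small)
                     (λ w → opp (side u) w Subset.∈ S)
                     (λ w w∈S → key-∈ idx (∈-elements S w∈S) (idx-opp (side u) w))
      ... | w , w∉S = step (to-opp u w refl , u∉S , w∉S)
                           (step (from-opp w v (≡-sym same) , w∉S , v∉S) here)

  module EdgeDeletion (F : List (V × V)) (few : length F < N) where

    Deleted : V → V → Set
    Deleted x y = (x , y) ∈ F ⊎ (y , x) ∈ F

    Kept : V → V → Set
    Kept x y = Adj K x y × ¬ ((x , y) ∈ F) × ¬ ((y , x) ∈ F)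

    kept : ∀ {x y} → Adj K x y → ¬ Deleted x y → Kept x y
    kept xy not-deleted = xy , not-deleted ∘ inj₁ , not-deleted ∘ inj₂

    -- For a pair with one endpoint on side s, the index of the other endpoint.
    -- A deleted edge from a vertex of side s can block only the route through
    -- the vertex with this index.
    far-index : Bool → V × V → Fin N
    far-index s (x , y) = if side x xor s then idx x else idx y

    far-index-second : ∀ a w → far-index (side a) (a , opp (side a) w) ≡ w
    far-index-second a w rewrite xor-same (side a) = idx-opp (side a) w

    far-index-first : ∀ s a w → far-index s (opp s w , a) ≡ w
    far-index-first false a w rewrite side-opp false w = idx-opp false w
    far-index-first true  a w rewrite side-opp true  w = idx-opp true  w

    deleted-index : ∀ {s} a w → side a ≡ s → Deleted a (opp s w) → w ∈ map (far-index s) F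
    deleted-index a w refl (inj₁ a-w∈F) = key-∈ (far-index (side a)) a-w∈F (far-index-second a w)
    deleted-index a w refl (inj₂ w-a∈F) = key-∈ (far-index (side a)) w-a∈F (far-index-first (side a) a w)

    same-side : ∀ u v → side u ≡ side v → Walk Kept u v
    same-side u v same
      with avoid (far-index (side u)) F few
                 (λ w → Deleted u (opp (side u) w) ⊎ Deleted v (opp (side u) w))
                 (λ w → [ deleted-index u w refl , deleted-index v w (≡-sym same) ])
    ... | w , w-free = step (kept (to-opp u w refl) (w-free ∘ inj₁))
                            (step (kept (from-opp w v (≡-sym same)) (w-free ∘ inj₂ ∘ swap)) here)

    walk : ∀ u v → Walk Kept u v
    walk u v with side u Bool.≟ side v
    ... | yes same = same-side u v same
    ... | no different
        with avoid (far-index (side u)) F few (λ w → Deleted u (opp (side u) w))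
                   (λ w → deleted-index u w refl)
    ... | w , w-free =
      step (kept (to-opp u w refl) w-free)
           (same-side (opp (side u) w) v (trans (side-opp (side u) w) (≡-sym (other-side u v different))))

  edge-connected : EdgeConnected N K
  edge-connected = ≤-trans (s≤s (s≤s z≤n)) N<N+N , EdgeDeletion.walk

-- The theorem: for a ≥ 1, K_{2a,2a} is 2a-connected, 2a-edge-connected and
-- 2*-dense.  For a = a′ + 1, the number 2 * a computes to suc (a′ + suc (a′ + 0)).
proposition2p6 : (a : ℕ) → 1 ≤ a →
    ∃ λ n → Σ (Graph n) λ G →
      Connected (2 * a) G × EdgeConnected (2 * a) G × DenseStar 2 G
proposition2p6 (suc a′) _ = _ , K , connected , edge-connected , 2*-dense
  where open CompleteBipartite (a′ + suc (a′ + 0))
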